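{- For every $\mathcal{L}_2$-formula $A$: $\mathbf{GR} \vdash A$ if and only if $\mathbf{GR}^\circ \vdash \Box A$.
   Context: $\mathcal{L}_2$ is the bimodal propositional language with countably many propositional variables, the constant $\bot$, connectives $\neg,\vee$ (other connectives defined as usual), and unary modal operators $\Box$ and $\blacksquare$; $\Diamond$ abbreviates $\neg\Box\neg$. The logic $\mathbf{GR}^-$ has as axioms all propositional tautologies of $\mathcal{L}_2$ and all instances of: $\Box(A\to B)\to(\Box A\to\Box B)$; $\Box(\Box A\to A)\to\Box A$; $\blacksquare A\to\Box A$; $\Box A\to\Box\blacksquare A$; $\Box A\to(\Box\bot\vee\blacksquare A)$; $\Diamond\blacksquare A\to\Diamond A$; its rules are modus ponens and $\Box$-necessitation (from $A$ infer $\Box A$). $\mathbf{GR}$ is obtained from $\mathbf{GR}^-$ by adding the rule: from $\Box A$ infer $A$. $\mathbf{GR}^\circ$ is obtained from $\mathbf{GR}^-$ by adding the $\blacksquare$-necessitation rule: from $A$ infer $\blacksquare A$. -}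

module Defs where

open import Data.Nat using (ℕ)
open import Data.Bool using (Bool; true; false; not; _∨_)
open import Relation.Binary.PropositionalEquality using (_≡_)

data Fm : Set where
  var  : ℕ → Fm
  ⊥'   : Fm
  ¬'_  : Fm → Fm
  _∨'_ : Fm → Fm → Fm
  □_   : Fm → Fm
  ■_   : Fm → Fm

infixr 6 _∨'_
infixr 4 _⇒_
infix 8 ¬'_ □_ ■_ ◇_

_⇒_ : Fm → Fm → Fm
A ⇒ B = ¬' A ∨' B

◇_ : Fm → Fm
◇ A = ¬' □ ¬' A

-- Propositional tautologies of L₂: formulas true under every Boolean
-- assignment to the propositional atoms of L₂, i.e. variables and
-- modalized formulas □B, ■B (treated as atoms).
record Valuation : Set where
  field
    vVar : ℕ → Bool
    vBox : Fm → Bool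
    vBlk : Fm → Bool
open Valuation

eval : Valuation → Fm → Bool
eval v (var n)   = vVar v n
eval v ⊥'        = false
eval v (¬' A)    = not (eval v A)
eval v (A ∨' B)  = eval v A ∨ eval v B
eval v (□ A)     = vBox v A
eval v (■ A)     = vBlk v A

Tautology : Fm → Set
Tautology A = (v : Valuation) → eval v A ≡ true

data Axiom : Fm → Set where
  taut  : ∀ {A} → Tautology A → Axiom A
  axK   : ∀ A B → Axiom (□ (A ⇒ B) ⇒ (□ A ⇒ □ B))
  axL   : ∀ A → Axiom (□ (□ A ⇒ A) ⇒ □ A)
  ax1   : ∀ A → Axiom (■ A ⇒ □ A)
  ax2   : ∀ A → Axiom (□ A ⇒ □ ■ A)
  ax3   : ∀ A → Axiom (□ A ⇒ (□ ⊥' ∨' ■ A))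
  ax4   : ∀ A → Axiom (◇ ■ A ⇒ ◇ A)

data GR⁻⊢_ : Fm → Set where
  ax  : ∀ {A} → Axiom A → GR⁻⊢ A
  mp  : ∀ {A B} → GR⁻⊢ (A ⇒ B) → GR⁻⊢ A → GR⁻⊢ B
  nec : ∀ {A} → GR⁻⊢ A → GR⁻⊢ (□ A)

data GR⊢_ : Fm → Set where
  ax    : ∀ {A} → Axiom A → GR⊢ A
  mp    : ∀ {A B} → GR⊢ (A ⇒ B) → GR⊢ A → GR⊢ B
  nec   : ∀ {A} → GR⊢ A → GR⊢ (□ A)
  unbox : ∀ {A} → GR⊢ (□ A) → GR⊢ A

data GR°⊢_ : Fm → Set where
  ax   : ∀ {A} → Axiom A → GR°⊢ A
  mp   : ∀ {A B} → GR°⊢ (A ⇒ B) → GR°⊢ A → GR°⊢ B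
  nec  : ∀ {A} → GR°⊢ A → GR°⊢ (□ A)
  nec■ : ∀ {A} → GR°⊢ A → GR°⊢ (■ A)

-- Every rule of GR except □□A / □A translates into a boxed GR°-derivation
-- directly (■-necessitation is recovered in GR from axiom 2 and the unboxing
-- rule), so everything rests on the admissibility of □□A / □A in GR°.  That
-- is a gluing argument.  Interpret formulas at an upper world, where □B means
-- GR° ⊢ □B, and at a lower world, where □B means that B holds at the upper
-- world and GR° ⊢ □B.  Truth is read in continuation style with answer type
-- R = (GR° ⊢ □A): classical tautologies stay valid, and a clash between
-- □B and □¬B yields the answer by ex falso under the box.  Soundness at the
-- lower world turns a derivation of □□A into truth of □A at the upper world,
-- which for this answer type is a derivation of □A.
module Submission where

open import Defs
open import Data.Bool using (Bool; true; false; not; _∨_; if_then_else_)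
import Data.Nat as ℕ
open import Data.Product using (Σ; _×_; _,_; uncurry)
open import Data.Unit using (⊤; tt)
open import Function using (id; _∘_)
open import Relation.Binary.Definitions using (DecidableEquality)
open import Relation.Binary.PropositionalEquality using (_≡_; _≢_; refl; cong; cong₂)
open import Relation.Nullary.Decidable using (yes; no; does; map′; _×-dec_)
open import Relation.Nullary.Negation using (contradiction)
open Valuation

infix 4 _≟_

_≟_ : DecidableEquality Fm
var m ≟ var n = map′ (cong var) (λ { refl → refl }) (m ℕ.≟ n)
⊥' ≟ ⊥' = yes refl
¬' A ≟ ¬' B = map′ (cong ¬'_) (λ { refl → refl }) (A ≟ B)
(A ∨' B) ≟ (C ∨' D) =
  map′ (uncurry (cong₂ _∨'_)) (λ { refl → refl , refl }) (A ≟ C ×-dec B ≟ D)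
□ A ≟ □ B = map′ (cong □_) (λ { refl → refl }) (A ≟ B)
■ A ≟ ■ B = map′ (cong ■_) (λ { refl → refl }) (A ≟ B)
var _ ≟ ⊥' = no λ () ; var _ ≟ ¬' _ = no λ () ; var _ ≟ _ ∨' _ = no λ () ; var _ ≟ □ _ = no λ () ; var _ ≟ ■ _ = no λ ()
⊥' ≟ var _ = no λ () ; ⊥' ≟ ¬' _ = no λ () ; ⊥' ≟ _ ∨' _ = no λ () ; ⊥' ≟ □ _ = no λ () ; ⊥' ≟ ■ _ = no λ ()
¬' _ ≟ var _ = no λ () ; ¬' _ ≟ ⊥' = no λ () ; ¬' _ ≟ _ ∨' _ = no λ () ; ¬' _ ≟ □ _ = no λ () ; ¬' _ ≟ ■ _ = no λ ()
_ ∨' _ ≟ var _ = no λ () ; _ ∨' _ ≟ ⊥' = no λ () ; _ ∨' _ ≟ ¬' _ = no λ () ; _ ∨' _ ≟ □ _ = no λ () ; _ ∨' _ ≟ ■ _ = no λ ()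
□ _ ≟ var _ = no λ () ; □ _ ≟ ⊥' = no λ () ; □ _ ≟ ¬' _ = no λ () ; □ _ ≟ _ ∨' _ = no λ () ; □ _ ≟ ■ _ = no λ ()
■ _ ≟ var _ = no λ () ; ■ _ ≟ ⊥' = no λ () ; ■ _ ≟ ¬' _ = no λ () ; ■ _ ≟ _ ∨' _ = no λ () ; ■ _ ≟ □ _ = no λ ()

-- Only meaningful for an atom X, that is a variable, □B or ■B.
assign : Valuation → Fm → Bool → Valuation
assign v X b = record
  { vVar = λ n → override (var n) (vVar v n)
  ; vBox = λ B → override (□ B) (vBox v B)
  ; vBlk = λ B → override (■ B) (vBlk v B)
  }
  where
  override : Fm → Bool → Bool
  override Y old = if does (Y ≟ X) then b else old

-- Friedman-style reading with answer type R: ¬R plays the role of negation.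
-- Variables are read as ⊥; nothing depends on their meaning.
module Semantics (R : Set) (P Q : Fm → Set) where

  ¬R_ : Set → Set
  ¬R S = S → R

  DN : Set → Set
  DN S = ¬R ¬R S

  return : {S : Set} → S → DN S
  return s k = k s

  _>>=_ : {S T : Set} → DN S → (S → DN T) → DN T
  (m >>= f) k = m λ s → f s k

  _<$>_ : {S T : Set} → (S → T) → DN S → DN T
  f <$> m = m >>= (return ∘ f)

  ⟦_⟧ : Fm → Set
  ⟦ var n ⟧ = R
  ⟦ ⊥' ⟧ = R
  ⟦ ¬' A ⟧ = ¬R ⟦ A ⟧
  ⟦ A ∨' B ⟧ = ¬R ⟦ A ⟧ → ¬R ⟦ B ⟧ → R
  ⟦ □ B ⟧ = DN (P B)
  ⟦ ■ B ⟧ = DN (Q B)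

  stable : ∀ X → DN ⟦ X ⟧ → ⟦ X ⟧
  stable (var n) k = k id
  stable ⊥' k = k id
  stable (¬' A) k a = k λ f → f a
  stable (A ∨' B) k f g = k λ h → h f g
  stable (□ B) k f = k λ h → h f
  stable (■ B) k f = k λ h → h f

  ⇒-intro : ∀ A B → (⟦ A ⟧ → ⟦ B ⟧) → ⟦ A ⇒ B ⟧
  ⇒-intro A B f g h = g λ a → h (f a)

  ⇒-elim : ∀ A B → ⟦ A ⇒ B ⟧ → ⟦ A ⟧ → ⟦ B ⟧
  ⇒-elim A B f a = stable B (f λ na → na a)

  Agrees : Bool → Set → Set
  Agrees true S = S
  Agrees false S = ¬R S

  agreeing-bool : (S : Set) → DN (Σ Bool λ b → Agrees b S)
  agreeing-bool S k = k (false , λ s → k (true , s))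

  Agrees-true : ∀ {b S} → b ≡ true → Agrees b S → S
  Agrees-true refl s = s

  Agrees-not : ∀ b {S} → Agrees b S → Agrees (not b) (¬R S)
  Agrees-not true s k = k s
  Agrees-not false ¬s = ¬s

  Agrees-∨ : ∀ a b {S T} → Agrees a S → Agrees b T → Agrees (a ∨ b) (¬R S → ¬R T → R)
  Agrees-∨ true b s t f g = f s
  Agrees-∨ false true s t f g = g t
  Agrees-∨ false false ¬s ¬t h = h ¬s ¬t

  Faithful : Valuation → Fm → Set
  Faithful v (var n) = Agrees (vVar v n) ⟦ var n ⟧
  Faithful v ⊥' = ⊤
  Faithful v (¬' A) = Faithful v A
  Faithful v (A ∨' B) = Faithful v A × Faithful v B
  Faithful v (□ B) = Agrees (vBox v B) ⟦ □ B ⟧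
  Faithful v (■ B) = Agrees (vBlk v B) ⟦ ■ B ⟧

  eval-agrees : ∀ v X → Faithful v X → Agrees (eval v X) ⟦ X ⟧
  eval-agrees v (var n) f = f
  eval-agrees v ⊥' _ = id
  eval-agrees v (¬' A) f = Agrees-not (eval v A) (eval-agrees v A f)
  eval-agrees v (A ∨' B) (f , g) = Agrees-∨ (eval v A) (eval v B) (eval-agrees v A f) (eval-agrees v B g)
  eval-agrees v (□ B) f = f
  eval-agrees v (■ B) f = f

  Agrees-override : ∀ X Y {b old} → Agrees b ⟦ X ⟧ → (Y ≢ X → Agrees old ⟦ Y ⟧) →
                    Agrees (if does (Y ≟ X) then b else old) ⟦ Y ⟧
  Agrees-override X Y agX agY with Y ≟ X
  ... | yes refl = agX
  ... | no Y≢X = agY Y≢X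

  Refines : Valuation → Valuation → Set
  Refines v w = ∀ Y → Faithful v Y → Faithful w Y

  assign-refines : ∀ v X b → Agrees b ⟦ X ⟧ → Refines v (assign v X b)
  assign-refines v X b ag (var n) f = Agrees-override X (var n) ag λ _ → f
  assign-refines v X b ag ⊥' _ = tt
  assign-refines v X b ag (¬' A) f = assign-refines v X b ag A f
  assign-refines v X b ag (A ∨' B) (f , g) = assign-refines v X b ag A f , assign-refines v X b ag B g
  assign-refines v X b ag (□ B) f = Agrees-override X (□ B) ag λ _ → f
  assign-refines v X b ag (■ B) f = Agrees-override X (■ B) ag λ _ → f

  Extension : Valuation → Fm → Set
  Extension v X = Σ Valuation λ w → Refines v w × Faithful w X

  extend-atom : ∀ v X → (∀ {b} → Agrees b ⟦ X ⟧ → Faithful (assign v X b) X) → DN (Extension v X)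
  extend-atom v X faithful = do
    (b , ag) ← agreeing-bool ⟦ X ⟧
    return (assign v X b , assign-refines v X b ag , faithful ag)

  faithful-extension : ∀ v X → DN (Extension v X)
  faithful-extension v (var n) = extend-atom v (var n) λ ag → Agrees-override (var n) (var n) ag (contradiction refl)
  faithful-extension v ⊥' = return (v , (λ _ → id) , tt)
  faithful-extension v (¬' A) = faithful-extension v A
  faithful-extension v (A ∨' B) = do
    (v₁ , v⊑v₁ , fA) ← faithful-extension v A
    (v₂ , v₁⊑v₂ , fB) ← faithful-extension v₁ B
    return (v₂ , (λ Y → v₁⊑v₂ Y ∘ v⊑v₁ Y) , v₁⊑v₂ A fA , fB)
  faithful-extension v (□ B) = extend-atom v (□ B) λ ag → Agrees-override (□ B) (□ B) ag (contradiction refl)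
  faithful-extension v (■ B) = extend-atom v (■ B) λ ag → Agrees-override (■ B) (■ B) ag (contradiction refl)

  tautology-valid : ∀ {X} → Tautology X → ⟦ X ⟧
  tautology-valid {X} t = stable X do
    (w , _ , f) ← faithful-extension v₀ X
    return (Agrees-true (t w) (eval-agrees w X f))
    where
    v₀ : Valuation
    v₀ = record { vVar = λ _ → false ; vBox = λ _ → false ; vBlk = λ _ → false }

record Closed (P : Fm → Set) : Set where
  field
    theorem : ∀ {A} → GR°⊢ A → P A
    modus-ponens : ∀ {A B} → P (A ⇒ B) → P A → P B
    löb : ∀ {A} → P (□ A ⇒ A) → P A
    ■-intro : ∀ {A} → P A → P (■ A)
    ◇-rule : ∀ {A} → P (¬' A) → P (¬' ■ A)

-- ■ is read like □, which validates axioms 1 and 3 outright.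
module Soundness (R : Set) {P : Fm → Set} (closed : Closed P) where
  open Closed closed
  open Semantics R P P

  axiom-valid : ∀ {X} → Axiom X → ⟦ X ⟧
  axiom-valid (taut t) = tautology-valid t
  axiom-valid (axK A B) = ⇒-intro (□ (A ⇒ B)) (□ A ⇒ □ B) λ p → ⇒-intro (□ A) (□ B) λ q → do
    pA⇒B ← p
    pA ← q
    return (modus-ponens pA⇒B pA)
  axiom-valid (axL A) = ⇒-intro (□ (□ A ⇒ A)) (□ A) (löb <$>_)
  axiom-valid (ax1 A) = ⇒-intro (■ A) (□ A) id
  axiom-valid (ax2 A) = ⇒-intro (□ A) (□ ■ A) (■-intro <$>_)
  axiom-valid (ax3 A) = ⇒-intro (□ A) (□ ⊥' ∨' ■ A) λ p _ g → g p
  axiom-valid (ax4 A) = ⇒-intro (◇ ■ A) (◇ A) λ x h → x (◇-rule <$> h)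

  sound : ∀ {X} → GR°⊢ X → ⟦ X ⟧
  sound (ax a) = axiom-valid a
  sound (mp {A} {B} d e) = ⇒-elim A B (sound d) (sound e)
  sound (nec d) = return (theorem d)
  sound (nec■ d) = return (theorem d)

module Gluing (R : Set) {P : Fm → Set} (closed : Closed P)
              (explode : ∀ {A} → P A → P (¬' A) → R) where
  open Closed closed
  open Semantics R P P
  open Soundness R closed

  Glued : Fm → Set
  Glued B = ⟦ B ⟧ × P B

  glued-closed : Closed Glued
  glued-closed = record
    { theorem = λ d → sound d , theorem d
    ; modus-ponens = λ { {A} {B} (f , p) (a , q) → ⇒-elim A B f a , modus-ponens p q }
    ; löb = λ { {A} (f , p) → ⇒-elim (□ A) A f (return (löb p)) , löb p }
    ; ■-intro = λ (_ , p) → return p , ■-intro p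
    ; ◇-rule = λ (_ , p¬) → (λ m → m λ p → explode p p¬) , ◇-rule p¬
    }

derive-by-taut : ∀ {A B} → Tautology (A ⇒ B) → GR°⊢ A → GR°⊢ B
derive-by-taut t = mp (ax (taut t))

□-mp : ∀ {A B} → GR°⊢ (□ (A ⇒ B)) → GR°⊢ (□ A) → GR°⊢ (□ B)
□-mp {A} {B} d e = mp (mp (ax (axK A B)) d) e

contraposition : ∀ A B → Tautology ((¬' A ⇒ ¬' B) ⇒ (B ⇒ A))
contraposition A B v with eval v A | eval v B
... | true | true = refl
... | true | false = refl
... | false | true = refl
... | false | false = refl

ex-falso : ∀ A C → Tautology (A ⇒ ¬' A ⇒ C)
ex-falso A C v with eval v A
... | true = refl
... | false = refl

□-ex-falso : ∀ {A} C → GR°⊢ (□ A) → GR°⊢ (□ ¬' A) → GR°⊢ (□ C)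
□-ex-falso {A} C d e = □-mp (□-mp (nec (ax (taut (ex-falso A C)))) d) e

Provable : Fm → Set
Provable B = GR°⊢ (□ B)

provable-closed : Closed Provable
provable-closed = record
  { theorem = nec
  ; modus-ponens = □-mp
  ; löb = λ {A} → mp (ax (axL A))
  ; ■-intro = λ {A} → mp (ax (ax2 A))
  ; ◇-rule = λ {A} → mp (derive-by-taut (contraposition (□ ¬' ■ A) (□ ¬' A)) (ax (ax4 A)))
  }

□-unbox : ∀ {A} → GR°⊢ (□ □ A) → GR°⊢ (□ A)
□-unbox {A} d = sound d λ (upper , _) → upper id
  where
  open Gluing (GR°⊢ (□ A)) provable-closed (□-ex-falso A)
  open Soundness (GR°⊢ (□ A)) glued-closed

GR°→GR : ∀ {A} → GR°⊢ A → GR⊢ A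
GR°→GR (ax a) = ax a
GR°→GR (mp d e) = mp (GR°→GR d) (GR°→GR e)
GR°→GR (nec d) = nec (GR°→GR d)
GR°→GR (nec■ {A} d) = unbox (mp (ax (ax2 A)) (nec (GR°→GR d)))

GR→□GR° : ∀ {A} → GR⊢ A → GR°⊢ (□ A)
GR→□GR° (ax a) = nec (ax a)
GR→□GR° (mp d e) = □-mp (GR→□GR° d) (GR→□GR° e)
GR→□GR° (nec {A} d) = □-mp (nec (ax (ax1 A))) (mp (ax (ax2 A)) (GR→□GR° d))
GR→□GR° (unbox d) = □-unbox (GR→□GR° d)

proposition3p2 : (A : Fm) → ((GR⊢ A → GR°⊢ (□ A)) × (GR°⊢ (□ A) → GR⊢ A))
proposition3p2 A = GR→□GR° , unbox ∘ GR°→GR
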